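{- Let $M$ be a set with a binary operation $\to$ and a constant $e$ satisfying, for all $x,y,z\in M$: $x\to x=e$ (Reflexivity), $e\to x=x$ (Unit-reduction), and $(t(x,y)\to x)\to(t(x,y)\to z)=x\to z$ (M-axiom), where $t(x,y)=(x\to y)\to y$. Define $a\le b$ iff $a\to b=e$. \begin{enumerate} \item For all $a,b\in M$, $a\le b$ implies $t(a,b)=b$; and $\le$ is a preorder on $M$. \item Assume moreover that $\to$ is increasing in its second argument (i.e. $b\le c$ implies $(a\to b)\le(a\to c)$) and that $M$ satisfies Implicative commutativity $x\to(y\to z)=y\to(x\to z)$. Then $\to$ is decreasing in its first argument (i.e. $a\le b$ implies $(b\to c)\le(a\to c)$). Moreover, $t$ is a pre-order term and a relative closure term in $M$: writing $u\le_t w$ for $t(u,w)=w$, $\bar x=t(x,y)$ and $\bar{\bar x}=t(t(x,y),z)$, the algebra $M$ satisfies for all $x,y,z$: \begin{itemize} \item $t(x,x)=x$ and $t(x,t(t(x,y),z))=t(t(x,y),z)$; \item $t(x,\bar x)=\bar x$ (Left-absorption); \item $t(\bar x,y)\le_t \bar x$ (Right-absorption); \item $t(x,z)\le_t t(\bar x,z)$ (Left-monotonicity); \item $t(\bar x,t(x,z))=t(\bar x,z)$ (Flattening); \item $t(t(\bar{\bar x},\bar x),x)\le_t t(\bar{\bar x},x)$ (Closure stability). \end{itemize} \end{enumerate} -}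

module Defs where

open import Level using (Level; suc; _⊔_)
open import Relation.Binary.PropositionalEquality using (_≡_)
open import Relation.Binary.Structures using (IsPreorder)

record MAlgebra (a : Level) : Set (suc a) where
  field
    Carrier : Set a
    _⇒_     : Carrier → Carrier → Carrier
    e       : Carrier

  t : Carrier → Carrier → Carrier
  t x y = (x ⇒ y) ⇒ y

  field
    reflexivity    : ∀ x → x ⇒ x ≡ e
    unit-reduction : ∀ x → e ⇒ x ≡ x
    M-axiom        : ∀ x y z → (t x y ⇒ x) ⇒ (t x y ⇒ z) ≡ x ⇒ z

  infixr 5 _⇒_
  infix 4 _≤_ _≤t_

  _≤_ : Carrier → Carrier → Set a
  a ≤ b = a ⇒ b ≡ e

  _≤t_ : Carrier → Carrier → Set a
  u ≤t w = t u w ≡ w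

  IncreasingRight : Set a
  IncreasingRight = ∀ a b c → b ≤ c → (a ⇒ b) ≤ (a ⇒ c)

  DecreasingLeft : Set a
  DecreasingLeft = ∀ a b c → a ≤ b → (b ⇒ c) ≤ (a ⇒ c)

  ImplicativeCommutativity : Set a
  ImplicativeCommutativity = ∀ x y z → x ⇒ (y ⇒ z) ≡ y ⇒ (x ⇒ z)

{-# OPTIONS --safe #-}
module Submission where

-- Whenever a ≤ b we have t a b = e ⇒ b = b, so the M-axiom specialises to
-- (b ⇒ a) ⇒ (b ⇒ z) = a ⇒ z; this cancellation law gives transitivity of ≤ and
-- turns every inequality into a ≤t-statement. Implicative commutativity gives
-- x ≤ t x y and left antitonicity of ⇒, from which the absorption, monotonicity
-- and flattening laws follow by short computations. Closure stability reduces to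
-- t a b ≤ t a w for w ≤ b ≤ a, which rests on (d ⇒ w) ≤ w for d = t a b ⇒ a.

open import Defs
open import Level using (Level)
open import Data.Product using (_×_; _,_)
open import Relation.Binary.PropositionalEquality using (_≡_; refl; sym; trans; cong; isEquivalence; module ≡-Reasoning)
open import Relation.Binary.Structures using (IsPreorder)

module Properties {ℓ : Level} (M : MAlgebra ℓ) where
  open MAlgebra M
  open ≡-Reasoning

  ≤⇒≤t : ∀ {a b} → a ≤ b → a ≤t b
  ≤⇒≤t {a} {b} a≤b = begin
    (a ⇒ b) ⇒ b  ≡⟨ cong (_⇒ b) a≤b ⟩
    e ⇒ b        ≡⟨ unit-reduction b ⟩
    b            ∎

  t-idem : ∀ x → t x x ≡ x
  t-idem x = ≤⇒≤t (reflexivity x)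

  M-axiom-≤ : ∀ {a b} → a ≤ b → ∀ z → (b ⇒ a) ⇒ (b ⇒ z) ≡ a ⇒ z
  M-axiom-≤ {a} {b} a≤b z = begin
    (b ⇒ a) ⇒ (b ⇒ z)          ≡⟨ cong (λ u → (u ⇒ a) ⇒ (u ⇒ z)) (sym (≤⇒≤t a≤b)) ⟩
    (t a b ⇒ a) ⇒ (t a b ⇒ z)  ≡⟨ M-axiom a b z ⟩
    a ⇒ z                      ∎

  a≤b⇒[b⇒a]≤e : ∀ {a b} → a ≤ b → (b ⇒ a) ≤ e
  a≤b⇒[b⇒a]≤e {a} {b} a≤b = begin
    (b ⇒ a) ⇒ e        ≡⟨ cong ((b ⇒ a) ⇒_) (sym (reflexivity b)) ⟩
    (b ⇒ a) ⇒ (b ⇒ b)  ≡⟨ M-axiom-≤ a≤b b ⟩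
    a ⇒ b              ≡⟨ a≤b ⟩
    e                  ∎

  ≤-trans : ∀ {a b c} → a ≤ b → b ≤ c → a ≤ c
  ≤-trans {a} {b} {c} a≤b b≤c = begin
    a ⇒ c              ≡⟨ sym (M-axiom-≤ a≤b c) ⟩
    (b ⇒ a) ⇒ (b ⇒ c)  ≡⟨ cong ((b ⇒ a) ⇒_) b≤c ⟩
    (b ⇒ a) ⇒ e        ≡⟨ a≤b⇒[b⇒a]≤e a≤b ⟩
    e                  ∎

  ≤-reflexive : ∀ {a b} → a ≡ b → a ≤ b
  ≤-reflexive {a} refl = reflexivity a

  ≤-isPreorder : IsPreorder _≡_ _≤_
  ≤-isPreorder = record
    { isEquivalence = isEquivalence
    ; reflexive     = ≤-reflexive
    ; trans         = ≤-trans
    }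

module CommutativeProperties {ℓ : Level} (M : MAlgebra ℓ)
    (⇒-increasingʳ : MAlgebra.IncreasingRight M)
    (⇒-comm : MAlgebra.ImplicativeCommutativity M) where
  open MAlgebra M
  open Properties M
  open ≡-Reasoning

  x≤txy : ∀ x y → x ≤ t x y
  x≤txy x y = begin
    x ⇒ ((x ⇒ y) ⇒ y)  ≡⟨ ⇒-comm x (x ⇒ y) y ⟩
    (x ⇒ y) ⇒ (x ⇒ y)  ≡⟨ reflexivity (x ⇒ y) ⟩
    e                  ∎

  y≤x⇒y≤txy : ∀ {x y} → y ≤ x → y ≤ t x y
  y≤x⇒y≤txy {x} {y} y≤x = begin
    y ⇒ ((x ⇒ y) ⇒ y)  ≡⟨ ⇒-comm y (x ⇒ y) y ⟩
    (x ⇒ y) ⇒ (y ⇒ y)  ≡⟨ cong ((x ⇒ y) ⇒_) (reflexivity y) ⟩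
    (x ⇒ y) ⇒ e        ≡⟨ a≤b⇒[b⇒a]≤e y≤x ⟩
    e                  ∎

  ⇒-decreasingˡ : DecreasingLeft
  ⇒-decreasingˡ a b c a≤b = begin
    (b ⇒ c) ⇒ (a ⇒ c)  ≡⟨ ⇒-comm (b ⇒ c) a c ⟩
    a ⇒ t b c          ≡⟨ ≤-trans a≤b (x≤txy b c) ⟩
    e                  ∎

  t-monoˡ : ∀ {u v} x → u ≤ v → t u x ≤ t v x
  t-monoˡ {u} {v} x u≤v = ⇒-decreasingˡ (v ⇒ x) (u ⇒ x) x (⇒-decreasingˡ u v x u≤v)

  right-absorption : ∀ x y → t (t x y) y ≤ t x y
  right-absorption x y = begin
    t (t x y) y ⇒ ((x ⇒ y) ⇒ y)  ≡⟨ ⇒-comm (t (t x y) y) (x ⇒ y) y ⟩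
    (x ⇒ y) ⇒ t (t x y ⇒ y) y    ≡⟨ ≤-trans (x≤txy (x ⇒ y) y) (x≤txy (t x y ⇒ y) y) ⟩
    e                            ∎

  flattening : ∀ x y z → t (t x y) (t x z) ≡ t (t x y) z
  flattening x y z = begin
    (t x y ⇒ t x z) ⇒ t x z                    ≡⟨ cong (_⇒ t x z) (⇒-comm (t x y) (x ⇒ z) z) ⟩
    ((x ⇒ z) ⇒ (t x y ⇒ z)) ⇒ ((x ⇒ z) ⇒ z)    ≡⟨ M-axiom-≤ (⇒-decreasingˡ x (t x y) z (x≤txy x y)) z ⟩
    (t x y ⇒ z) ⇒ z                            ∎

  module _ {a b : Carrier} (b≤a : b ≤ a) where
    private
      c T d k : Carrier
      c = a ⇒ b
      T = c ⇒ b
      d = T ⇒ a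
      k = T ⇒ b

      b≤T : b ≤ T
      b≤T = y≤x⇒y≤txy b≤a

      d⇒k≡c : d ⇒ k ≡ c
      d⇒k≡c = M-axiom a b b

      k≤d : k ≤ d
      k≤d = trans (M-axiom-≤ b≤T a) b≤a

      c≤k : c ≤ k
      c≤k = x≤txy c b

      d⇒[b⇒x]≤b⇒x : ∀ x → (d ⇒ (b ⇒ x)) ≤ (b ⇒ x)
      d⇒[b⇒x]≤b⇒x x = begin
        (d ⇒ (b ⇒ x)) ⇒ (b ⇒ x)              ≡⟨ cong (λ u → (d ⇒ u) ⇒ u) (sym (M-axiom-≤ b≤a x)) ⟩
        (d ⇒ (c ⇒ y)) ⇒ (c ⇒ y)              ≡⟨ cong (_⇒ (c ⇒ y)) (⇒-comm d c y) ⟩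
        (c ⇒ (d ⇒ y)) ⇒ (c ⇒ y)              ≡⟨ cong (λ u → (u ⇒ (d ⇒ y)) ⇒ (c ⇒ y)) (sym d⇒k≡c) ⟩
        ((d ⇒ k) ⇒ (d ⇒ y)) ⇒ (c ⇒ y)        ≡⟨ cong (_⇒ (c ⇒ y)) (M-axiom-≤ k≤d y) ⟩
        (k ⇒ y) ⇒ (c ⇒ y)                    ≡⟨ ⇒-decreasingˡ c k y c≤k ⟩
        e                                    ∎
        where
        y : Carrier
        y = a ⇒ x

      d⇒b≤b : (d ⇒ b) ≤ b
      d⇒b≤b = begin
        (d ⇒ b) ⇒ b              ≡⟨ sym (M-axiom-≤ d⇒b≤T b) ⟩
        (T ⇒ (d ⇒ b)) ⇒ (T ⇒ b)  ≡⟨ cong (_⇒ k) (trans (⇒-comm T d b) d⇒k≡c) ⟩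
        c ⇒ k                    ≡⟨ c≤k ⟩
        e                        ∎
        where
        d⇒b≤T : (d ⇒ b) ≤ T
        d⇒b≤T = ≤-trans (⇒-decreasingˡ k d b k≤d) (right-absorption a b)

      d⇒w≤w : ∀ {w} → w ≤ b → (d ⇒ w) ≤ w
      d⇒w≤w {w} w≤b = begin
        (d ⇒ w) ⇒ w              ≡⟨ sym (M-axiom-≤ d⇒w≤b w) ⟩
        (b ⇒ (d ⇒ w)) ⇒ (b ⇒ w)  ≡⟨ cong (_⇒ (b ⇒ w)) (⇒-comm b d w) ⟩
        (d ⇒ (b ⇒ w)) ⇒ (b ⇒ w)  ≡⟨ d⇒[b⇒x]≤b⇒x w ⟩
        e                        ∎
        where
        d⇒w≤b : (d ⇒ w) ≤ b
        d⇒w≤b = ≤-trans (⇒-increasingʳ d w b w≤b) d⇒b≤b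

    t-antitoneʳ : ∀ {w} → w ≤ b → t a b ≤ t a w
    t-antitoneʳ {w} w≤b = begin
      T ⇒ ((a ⇒ w) ⇒ w)          ≡⟨ ⇒-comm T (a ⇒ w) w ⟩
      (a ⇒ w) ⇒ (T ⇒ w)          ≡⟨ cong (_⇒ (T ⇒ w)) (trans (sym (M-axiom a b w)) (⇒-comm d T w)) ⟩
      (T ⇒ (d ⇒ w)) ⇒ (T ⇒ w)    ≡⟨ M-axiom-≤ (≤-trans (d⇒w≤w w≤b) (≤-trans w≤b b≤T)) w ⟩
      (d ⇒ w) ⇒ w                ≡⟨ d⇒w≤w w≤b ⟩
      e                          ∎

  closure-stability : ∀ {x s S} → x ≤ s → s ≤ S → t (t S s) x ≤ t S x
  closure-stability {x} {s} {S} x≤s s≤S =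
    ≤-trans (t-monoˡ x (t-antitoneʳ s≤S x≤s)) (right-absorption S x)

mainTheorem2 : ∀ {ℓ : Level} (M : MAlgebra ℓ) → let open MAlgebra M in
    ((∀ a b → a ≤ b → t a b ≡ b) × IsPreorder _≡_ _≤_)
    × (IncreasingRight → ImplicativeCommutativity →
        DecreasingLeft
        × (∀ x → t x x ≡ x)
        × (∀ x y z → t x (t (t x y) z) ≡ t (t x y) z)
        × (∀ x y → t x (t x y) ≡ t x y)
        × (∀ x y → t (t x y) y ≤t t x y)
        × (∀ x y z → t x z ≤t t (t x y) z)
        × (∀ x y z → t (t x y) (t x z) ≡ t (t x y) z)
        × (∀ x y z → t (t (t (t x y) z) (t x y)) x ≤t t (t (t x y) z) x))
mainTheorem2 M =
    ((λ _ _ → ≤⇒≤t) , ≤-isPreorder)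
  , λ inc comm → let open CommutativeProperties M inc comm in
      ⇒-decreasingˡ
    , t-idem
    , (λ x y z → ≤⇒≤t (≤-trans (x≤txy x y) (x≤txy (t x y) z)))
    , (λ x y → ≤⇒≤t (x≤txy x y))
    , (λ x y → ≤⇒≤t (right-absorption x y))
    , (λ x y z → ≤⇒≤t (t-monoˡ z (x≤txy x y)))
    , flattening
    , (λ x y z → ≤⇒≤t (closure-stability (x≤txy x y) (x≤txy (t x y) z)))
  where
  open MAlgebra M using (t)
  open Properties M
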